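{- Let $\mathcal F$ be a $\mathcal D_2$-saturated family of subsets of $[n]$, and let $S$ be a minimal element of $\mathcal F$ with respect to inclusion. Then $|\mathcal F|\geq |S|$.
   Context: The diamond poset $\mathcal D_2$ is the 4-element poset with one minimal element, one maximal element and two incomparable middle elements. A family $\mathcal F$ of subsets of $[n]$ contains an induced copy of $\mathcal D_2$ if there are four distinct sets $W,X,Y,Z\in\mathcal F$ with $W\subset X\subset Z$, $W\subset Y\subset Z$ and $X,Y$ incomparable under inclusion. $\mathcal F$ is $\mathcal D_2$-saturated if it contains no induced copy of $\mathcal D_2$, but for every $S\subseteq[n]$ with $S\notin\mathcal F$, the family $\mathcal F\cup\{S\}$ contains an induced copy of $\mathcal D_2$. -}

module Defs where

open import Data.Nat using (ℕ)
open import Data.List using (List; _∷_)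
open import Data.List.Membership.Propositional using (_∈_; _∉_)
open import Data.Fin.Subset using (Subset; _⊆_; _⊂_)
open import Data.Product using (Σ; _×_; ∃)
open import Relation.Nullary using (¬_)
open import Relation.Binary.PropositionalEquality using (_≡_)

-- A family of subsets of [n] is a list of subsets (duplicates are
-- excluded separately where needed via Unique); |F| is its length.
Family : ℕ → Set
Family n = List (Subset n)

Incomparable : ∀ {n} → Subset n → Subset n → Set
Incomparable X Y = ¬ (X ⊆ Y) × ¬ (Y ⊆ X)

-- F contains an induced copy of the diamond D2: W ⊂ X ⊂ Z, W ⊂ Y ⊂ Z,
-- X, Y incomparable (distinctness of W,X,Y,Z follows).
ContainsInducedD2 : ∀ {n} → Family n → Set
ContainsInducedD2 {n} F =
  Σ (Subset n) λ W → Σ (Subset n) λ X → Σ (Subset n) λ Y → Σ (Subset n) λ Z →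
    (W ∈ F) × (X ∈ F) × (Y ∈ F) × (Z ∈ F) ×
    (W ⊂ X) × (X ⊂ Z) × (W ⊂ Y) × (Y ⊂ Z) × Incomparable X Y

D2Saturated : ∀ {n} → Family n → Set
D2Saturated {n} F =
  ¬ ContainsInducedD2 F ×
  (∀ (S : Subset n) → S ∉ F → ContainsInducedD2 (S ∷ F))

MinimalIn : ∀ {n} → Subset n → Family n → Set
MinimalIn S F = S ∈ F × (∀ T → T ∈ F → ¬ (T ⊂ S))

{-# OPTIONS --safe #-}
module Submission where

-- For every i ∈ S, saturation puts an induced diamond into F ∪ {S ∖ i}. By
-- minimality of S the new set S ∖ i must be its bottom, so two incomparable
-- sets X, Y ∈ F lie strictly above S ∖ i. If both contained i, S itself would
-- be the bottom of an induced diamond in F; hence one of them meets S in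
-- exactly S ∖ i. Such a set determines i, so i ↦ (that set) injects S into F.

open import Defs
open import Data.Nat using (ℕ; _≤_; suc; z≤n; s≤s)
open import Data.Nat.Properties using (≤-trans; ≤-reflexive; module ≤-Reasoning)
open import Data.Bool using (true; false)
open import Data.Vec using ([]; _∷_)
import Data.Vec as Vec
open import Data.List using (List; []; _∷_; length; map)
open import Data.List.Properties using (length-map)
open import Data.List.Relation.Unary.Any using (here; there)
open import Data.List.Relation.Unary.All using (lookup; universal)
open import Data.List.Relation.Unary.All.Properties using (map⁺)
open import Data.List.Relation.Unary.AllPairs using ([]; _∷_)
open import Data.List.Relation.Unary.Unique.Propositional using (Unique)
import Data.List.Relation.Unary.Unique.Propositional.Properties as Unique
open import Data.List.Membership.Propositional using (_∈_; _∉_)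
open import Data.List.Membership.Propositional.Properties using (∈-map⁻)
open import Data.Fin using (Fin; zero; suc; _≟_)
open import Data.Fin.Properties using (suc-injective; ¬∀⟶∃¬)
open import Data.Fin.Subset using (Subset; ∣_∣; _⊆_; _⊈_; _⊂_; _⊄_; _-_)
  renaming (_∈_ to _∈ₛ_; _∉_ to _∉ₛ_)
open import Data.Fin.Subset.Properties
  using (_∈?_; ⊂-trans; ⊂-irref; ⊆-trans; x∈p∧x≢y⇒x∈p-y; x∈p⇒p-x⊂p)
open import Data.Product using (∃; _×_; _,_; proj₁; proj₂)
open import Data.Empty using (⊥-elim)
open import Function using (_∘_; const)
open import Relation.Nullary using (¬_; yes; no; contradiction)
open import Relation.Nullary.Decidable using (_→-dec_)
open import Relation.Binary.PropositionalEquality using (_≡_; _≢_; refl; sym; trans; cong)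

module _ {a} {A : Set a} where

  ∈-remove : ∀ {x : A} {ys} → x ∈ ys →
             ∃ λ ys′ → length ys ≡ suc (length ys′) × (∀ {y} → y ∈ ys → y ≢ x → y ∈ ys′)
  ∈-remove {ys = _ ∷ ys} (here refl) = ys , refl , λ where
    (here y≡x) y≢x → contradiction y≡x y≢x
    (there y∈ys) _ → y∈ys
  ∈-remove {ys = z ∷ ys} (there x∈ys) with ys′ , eq , keep ← ∈-remove x∈ys =
    z ∷ ys′ , cong suc eq , λ where
      (here y≡z) _ → here y≡z
      (there y∈ys) y≢x → there (keep y∈ys y≢x)

module _ {a b r} {A : Set a} {B : Set b} (R : A → B → Set r)
         (R-injective : ∀ {x x′ y} → R x y → R x′ y → x ≡ x′) where

  injection⇒length≤ : ∀ {xs ys} → Unique xs → (∀ {x} → x ∈ xs → ∃ λ y → y ∈ ys × R x y) →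
                      length xs ≤ length ys
  injection⇒length≤ {[]} _ _ = z≤n
  injection⇒length≤ {x ∷ xs} {ys} (x∉xs ∷ xs!) image
    with y , y∈ys , Rxy ← image (here refl)
    with ys′ , |ys|≡ , keep ← ∈-remove y∈ys =
    ≤-trans (s≤s (injection⇒length≤ xs! image′)) (≤-reflexive (sym |ys|≡))
    where
    image′ : ∀ {x′} → x′ ∈ xs → ∃ λ y′ → y′ ∈ ys′ × R x′ y′
    image′ x′∈xs with y′ , y′∈ys , Rx′y′ ← image (there x′∈xs) =
      y′ , keep y′∈ys (λ { refl → lookup x∉xs x′∈xs (R-injective Rxy Rx′y′) }) , Rx′y′

elements : ∀ {n} → Subset n → List (Fin n)
elements []          = []
elements (true ∷ p)  = zero ∷ map suc (elements p)
elements (false ∷ p) = map suc (elements p)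

length-elements : ∀ {n} (p : Subset n) → length (elements p) ≡ ∣ p ∣
length-elements []          = refl
length-elements (true ∷ p)  = cong suc (trans (length-map suc (elements p)) (length-elements p))
length-elements (false ∷ p) = trans (length-map suc (elements p)) (length-elements p)

∈-elements⁻ : ∀ {n} (p : Subset n) {x} → x ∈ elements p → x ∈ₛ p
∈-elements⁻ (true ∷ p) (here refl) = Vec.here
∈-elements⁻ (true ∷ p) (there x∈) with y , y∈ , refl ← ∈-map⁻ suc x∈ = Vec.there (∈-elements⁻ p y∈)
∈-elements⁻ (false ∷ p) x∈ with y , y∈ , refl ← ∈-map⁻ suc x∈ = Vec.there (∈-elements⁻ p y∈)

elements-unique : ∀ {n} (p : Subset n) → Unique (elements p)
elements-unique []          = []
elements-unique (true ∷ p)  =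
  map⁺ (universal (λ _ ()) (elements p)) ∷ Unique.map⁺ suc-injective (elements-unique p)
elements-unique (false ∷ p) = Unique.map⁺ suc-injective (elements-unique p)

p-x⊆q⇒p⊆q : ∀ {n} {p q : Subset n} {x} → p - x ⊆ q → x ∈ₛ q → p ⊆ q
p-x⊆q⇒p⊆q {x = x} p-x⊆q x∈q {y} y∈p with y ≟ x
... | yes refl = x∈q
... | no y≢x   = p-x⊆q (x∈p∧x≢y⇒x∈p-y y∈p y≢x)

p⊈q⇒∃ : ∀ {n} {p q : Subset n} → p ⊈ q → ∃ λ x → x ∈ₛ p × x ∉ₛ q
p⊈q⇒∃ {n} {p} {q} p⊈q
  with x , x∈p⇏x∈q ← ¬∀⟶∃¬ n (λ x → x ∈ₛ p → x ∈ₛ q) (λ x → x ∈? p →-dec x ∈? q) (λ p⊆q → p⊈q (p⊆q _))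
  with x ∈? p
... | yes x∈p = x , x∈p , x∈p⇏x∈q ∘ const
... | no x∉p  = contradiction (λ x∈p → contradiction x∈p x∉p) x∈p⇏x∈q

p⊆q∧q⊈p⇒p⊂q : ∀ {n} {p q : Subset n} → p ⊆ q → q ⊈ p → p ⊂ q
p⊆q∧q⊈p⇒p⊂q p⊆q q⊈p = p⊆q , p⊈q⇒∃ q⊈p

record DiamondOver {n} (F : Family n) (W : Subset n) : Set where
  field
    {X Y Z} : Subset n
    X∈F     : X ∈ F
    Y∈F     : Y ∈ F
    Z∈F     : Z ∈ F
    W⊂X     : W ⊂ X
    X⊂Z     : X ⊂ Z
    W⊂Y     : W ⊂ Y
    Y⊂Z     : Y ⊂ Z
    X∥Y     : Incomparable X Y

module _ {n : ℕ} where

  diamond : ∀ {F : Family n} {W} → W ∈ F → DiamondOver F W → ContainsInducedD2 F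
  diamond W∈F d = _ , _ , _ , _ , W∈F , X∈F , Y∈F , Z∈F , W⊂X , X⊂Z , W⊂Y , Y⊂Z , X∥Y
    where open DiamondOver d

  bottom : ∀ {F : Family n} → ContainsInducedD2 F → ∃ λ W → W ∈ F × DiamondOver F W
  bottom (W , _ , _ , _ , W∈F , X∈F , Y∈F , Z∈F , W⊂X , X⊂Z , W⊂Y , Y⊂Z , X∥Y) =
    W , W∈F , record { X∈F = X∈F ; Y∈F = Y∈F ; Z∈F = Z∈F ; W⊂X = W⊂X ; X⊂Z = X⊂Z
                     ; W⊂Y = W⊂Y ; Y⊂Z = Y⊂Z ; X∥Y = X∥Y }

  diamondOver-∷⁻ : ∀ {F : Family n} {T W} → W ⊄ T → DiamondOver (T ∷ F) W → DiamondOver F W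
  diamondOver-∷⁻ {F} {T} {W} W⊄T d = record
    { X∈F = above X∈F W⊂X ; Y∈F = above Y∈F W⊂Y ; Z∈F = above Z∈F (⊂-trans W⊂X X⊂Z)
    ; W⊂X = W⊂X ; X⊂Z = X⊂Z ; W⊂Y = W⊂Y ; Y⊂Z = Y⊂Z ; X∥Y = X∥Y }
    where
    open DiamondOver d
    above : ∀ {V} → V ∈ T ∷ F → W ⊂ V → V ∈ F
    above (here refl) W⊂T = contradiction W⊂T W⊄T
    above (there V∈F) _   = V∈F

  diamondOver-new : ∀ {F : Family n} {T} → ¬ ContainsInducedD2 F → (∀ {U} → U ∈ F → U ⊄ T) →
                    ContainsInducedD2 (T ∷ F) → DiamondOver F T
  diamondOver-new noD2 nothing-below D2
    with bottom D2
  ... | _ , here refl , d = diamondOver-∷⁻ (⊂-irref refl) d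
  ... | _ , there W∈F , d = ⊥-elim (noD2 (diamond W∈F (diamondOver-∷⁻ (nothing-below W∈F) d)))

  diamondOver-restore : ∀ {F : Family n} {S x} (d : DiamondOver F (S - x)) →
                        x ∈ₛ DiamondOver.X d → x ∈ₛ DiamondOver.Y d → DiamondOver F S
  diamondOver-restore {S = S} d x∈X x∈Y = record
    { X∈F = X∈F ; Y∈F = Y∈F ; Z∈F = Z∈F ; X⊂Z = X⊂Z ; Y⊂Z = Y⊂Z ; X∥Y = X∥Y
    ; W⊂X = p⊆q∧q⊈p⇒p⊂q S⊆X (λ X⊆S → proj₁ X∥Y (⊆-trans X⊆S S⊆Y))
    ; W⊂Y = p⊆q∧q⊈p⇒p⊂q S⊆Y (λ Y⊆S → proj₂ X∥Y (⊆-trans Y⊆S S⊆X)) }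
    where
    open DiamondOver d
    S⊆X : S ⊆ X
    S⊆X = p-x⊆q⇒p⊆q (proj₁ W⊂X) x∈X
    S⊆Y : S ⊆ Y
    S⊆Y = p-x⊆q⇒p⊆q (proj₁ W⊂Y) x∈Y

MissesExactly : ∀ {n} → Subset n → Fin n → Subset n → Set
MissesExactly S x X = x ∈ₛ S × x ∉ₛ X × S - x ⊆ X

missesExactly-injective : ∀ {n} {S X : Subset n} {x y} →
                          MissesExactly S x X → MissesExactly S y X → x ≡ y
missesExactly-injective {x = x} {y} (_ , _ , S-x⊆X) (y∈S , y∉X , _) with y ≟ x
... | yes y≡x = sym y≡x
... | no y≢x  = contradiction (S-x⊆X (x∈p∧x≢y⇒x∈p-y y∈S y≢x)) y∉X

module _ {n} {F : Family n} {S : Subset n} where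

  missingSet-in-diamond : ¬ ContainsInducedD2 F → S ∈ F → ∀ {x} → x ∈ₛ S →
                          DiamondOver F (S - x) → ∃ λ X → X ∈ F × MissesExactly S x X
  missingSet-in-diamond noD2 S∈F {x} x∈S d with x ∈? DiamondOver.X d | x ∈? DiamondOver.Y d
  ... | no x∉X | _       = _ , DiamondOver.X∈F d , x∈S , x∉X , proj₁ (DiamondOver.W⊂X d)
  ... | _      | no x∉Y  = _ , DiamondOver.Y∈F d , x∈S , x∉Y , proj₁ (DiamondOver.W⊂Y d)
  ... | yes x∈X | yes x∈Y = ⊥-elim (noD2 (diamond S∈F (diamondOver-restore d x∈X x∈Y)))

  missingSet : D2Saturated F → MinimalIn S F → ∀ {x} → x ∈ₛ S →
               ∃ λ X → X ∈ F × MissesExactly S x X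
  missingSet (noD2 , saturated) (S∈F , S-minimal) {x} x∈S =
    missingSet-in-diamond noD2 S∈F x∈S (diamondOver-new noD2 nothing-below (saturated (S - x) S-x∉F))
    where
    S-x⊂S : S - x ⊂ S
    S-x⊂S = x∈p⇒p-x⊂p x∈S
    S-x∉F : S - x ∉ F
    S-x∉F S-x∈F = S-minimal _ S-x∈F S-x⊂S
    nothing-below : ∀ {U} → U ∈ F → U ⊄ S - x
    nothing-below U∈F U⊂S-x = S-minimal _ U∈F (⊂-trans U⊂S-x S-x⊂S)

lemma1 : (n : ℕ) (F : Family n) → Unique F → D2Saturated F →
    (S : Subset n) → MinimalIn S F → ∣ S ∣ ≤ length F
lemma1 _ F _ saturated S S-minimal = begin
  ∣ S ∣                   ≡⟨ length-elements S ⟨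
  length (elements S)     ≤⟨ injection⇒length≤ (MissesExactly S) missesExactly-injective
                               (elements-unique S)
                               (missingSet saturated S-minimal ∘ ∈-elements⁻ S) ⟩
  length F                ∎
  where open ≤-Reasoning
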